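{- Let $G=\{g_1,\dots,g_m\}$ be a finite group, and let $\Gamma=(V,E)$ be a finite digraph with a voltage assignment $\alpha:E\to G$. Let $B_G$ be the $G$-representation matrix of $(\Gamma,\alpha)$, and for $\ell\ge 0$ let $B_G^\ell$ be its $\ell$-th power computed with $G$-convolution. If the $uv$-entry of $B_G^\ell$ is $(\beta_1,\dots,\beta_m)$, then for every $i=1,\dots,m$ and every $h\in G$ there are exactly $\beta_i$ walks of length $\ell$ in the lift $\Gamma^\alpha$ from vertex $(u,h)$ to vertex $(v,hg_i)$.
   Context: The lift $\Gamma^\alpha$ has vertex set $V\times G$ and an arc from $(u,g)$ to $(v,g\alpha(uv))$ for each arc $uv\in E$ and each $g\in G$. For $a,b\in\mathbb{N}^m$, their $G$-convolution is $a*_G b\in\mathbb{N}^m$ with $(a*_Gb)_i=\sum_{j,k:\,g_jg_k=g_i}a_jb_k$. The $G$-representation matrix $B_G$ is the $V\times V$ matrix whose entries are vectors $b_{uv}\in\mathbb{N}^m$ with $(b_{uv})_i$ equal to the number of arcs $uv\in E$ with $\alpha(uv)=g_i$. Products are defined by $(XY)_{uv}=\sum_{w\in V}X_{uw}*_GY_{wv}$; $B_G^0$ has diagonal entries the indicator vector of the identity element and zero vectors elsewhere. -}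

module Defs where

open import Data.Nat using (ℕ; zero; suc; _+_; _*_)
open import Data.Fin using (Fin; zero; suc)
open import Data.Fin.Properties using (_≟_)
open import Data.Product using (_×_; _,_; proj₁; proj₂)
open import Relation.Nullary using (yes; no)
open import Relation.Binary.PropositionalEquality using (_≡_)
open import Algebra.Structures using (IsGroup)

sumFin : ∀ {n} → (Fin n → ℕ) → ℕ
sumFin {zero}  f = 0
sumFin {suc n} f = f zero + sumFin (λ i → f (suc i))

[_≡ᶠ_] : ∀ {n} → Fin n → Fin n → ℕ
[ i ≡ᶠ j ] with i ≟ j
... | yes _ = 1
... | no  _ = 0

-- A finite group G = {g_1,…,g_m}, realised on the index set Fin m
-- (the element g_i is the index i), with propositional equality.
record FinGroup (m : ℕ) : Set where
  field
    _∙_     : Fin m → Fin m → Fin m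
    ε       : Fin m
    _⁻¹     : Fin m → Fin m
    isGroup : IsGroup _≡_ _∙_ ε _⁻¹

-- A finite digraph Γ = (V,E) (multiple arcs and loops allowed) with
-- V = Fin n, E = Fin k, and a voltage assignment α : E → G.
record VoltageDigraph (m : ℕ) : Set where
  field
    n k : ℕ
    src tgt : Fin k → Fin n
    α : Fin k → Fin m

record Digraph : Set₁ where
  field
    Vertex Arc : Set
    src tgt : Arc → Vertex

data Walk (D : Digraph) : ℕ → Digraph.Vertex D → Digraph.Vertex D → Set where
  []   : ∀ {x} → Walk D 0 x x
  step : ∀ {ℓ x y} (a : Digraph.Arc D) → Digraph.src D a ≡ x →
         Walk D ℓ (Digraph.tgt D a) y → Walk D (suc ℓ) x y

module _ {m : ℕ} (G : FinGroup m) where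
  open FinGroup G

  lift : VoltageDigraph m → Digraph
  lift Γ = record
    { Vertex = Fin n × Fin m
    ; Arc    = Fin k × Fin m
    ; src    = λ eg → src (proj₁ eg) , proj₂ eg
    ; tgt    = λ eg → tgt (proj₁ eg) , (proj₂ eg ∙ α (proj₁ eg))
    }
    where open VoltageDigraph Γ

  _*G_ : (Fin m → ℕ) → (Fin m → ℕ) → (Fin m → ℕ)
  (a *G b) i = sumFin λ j → sumFin λ k → [ j ∙ k ≡ᶠ i ] * (a j * b k)

  module _ (Γ : VoltageDigraph m) where
    open VoltageDigraph Γ

    Mat : Set
    Mat = Fin n → Fin n → Fin m → ℕ

    repMatrix : Mat
    repMatrix u v i = sumFin λ e → [ src e ≡ᶠ u ] * ([ tgt e ≡ᶠ v ] * [ α e ≡ᶠ i ])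

    _·_ : Mat → Mat → Mat
    (X · Y) u v i = sumFin (λ w → (X u w *G Y w v) i)

    idMat : Mat
    idMat u v i = [ u ≡ᶠ v ] * [ i ≡ᶠ ε ]

    _^G_ : Mat → ℕ → Mat
    B ^G zero  = idMat
    B ^G suc ℓ = (B ^G ℓ) · B

module Submission where

-- The counting statement is proved in its bijective form: for every ℓ, walks of
-- length ℓ from (u,h) to (v,h g_i) in Γ^α are in bijection with Fin of the
-- i-th coordinate of the uv-entry of B_G^ℓ.
-- The theorem follows by induction on ℓ: both sides of the step are the same
-- Σ-type once the bookkeeping indices w = src e and g = α(e) are eliminated.

open import Defs
open import Data.Nat using (ℕ; zero; suc; _+_)
open import Data.Fin using (Fin; zero; suc)
open import Data.Fin.Properties using (_≟_; +↔⊎; *↔×)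
open import Data.Product using (Σ; _×_; _,_)
open import Data.Product.Properties using (×-≡,≡↔≡)
open import Data.Product.Algebra using (Σ-assoc; ×-cong)
open import Data.Product.Function.Dependent.Propositional using (congˡ; Σ-↔)
open import Data.Sum using (_⊎_; inj₁; inj₂)
open import Data.Sum.Function.Propositional using (_⊎-↔_)
open import Data.Empty using (⊥-elim)
open import Relation.Nullary using (yes; no; Irrelevant)
open import Relation.Binary.PropositionalEquality
open import Axiom.UniquenessOfIdentityProofs using (module Decidable⇒UIP)
open import Algebra.Structures using (IsGroup)
open import Algebra.Bundles using (Group)
import Algebra.Properties.Group as GroupProperties
open import Level using (0ℓ)
open import Function.Base using (_∘_)
open import Function.Bundles using (_↔_; mk↔ₛ′)
open import Function.Properties.Inverse using (↔-refl; ↔-sym; ↔-trans)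
open import Function.Related.Propositional using (module EquationalReasoning)

prop-↔ : ∀ {A B : Set} → Irrelevant A → Irrelevant B → (A → B) → (B → A) → A ↔ B
prop-↔ irrA irrB f g = mk↔ₛ′ f g (λ _ → irrB _ _) (λ _ → irrA _ _)

Fin-≡-irrelevant : ∀ {n} {a b : Fin n} → Irrelevant (a ≡ b)
Fin-≡-irrelevant = Decidable⇒UIP.≡-irrelevant _≟_

Σ-Fin-suc↔⊎ : ∀ {n} (P : Fin (suc n) → Set) →
              Σ (Fin (suc n)) P ↔ (P zero ⊎ Σ (Fin n) (P ∘ suc))
Σ-Fin-suc↔⊎ P = mk↔ₛ′ to from to∘from from∘to
  where
  to : Σ (Fin _) P → P zero ⊎ Σ (Fin _) (P ∘ suc)
  to (zero  , p) = inj₁ p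
  to (suc i , p) = inj₂ (i , p)
  from : P zero ⊎ Σ (Fin _) (P ∘ suc) → Σ (Fin _) P
  from (inj₁ p)       = zero , p
  from (inj₂ (i , p)) = suc i , p
  to∘from : ∀ x → to (from x) ≡ x
  to∘from (inj₁ _)       = refl
  to∘from (inj₂ (_ , _)) = refl
  from∘to : ∀ x → from (to x) ≡ x
  from∘to (zero  , _) = refl
  from∘to (suc _ , _) = refl

Fin-sum↔Σ : ∀ {n} (f : Fin n → ℕ) → Fin (sumFin f) ↔ Σ (Fin n) (Fin ∘ f)
Fin-sum↔Σ {zero}  f = mk↔ₛ′ (λ ()) (λ { (() , _) }) (λ { (() , _) }) (λ ())
Fin-sum↔Σ {suc n} f = begin
  Fin (f zero + sumFin (f ∘ suc))           ↔⟨ +↔⊎ ⟩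
  (Fin (f zero) ⊎ Fin (sumFin (f ∘ suc)))   ↔⟨ ↔-refl ⊎-↔ Fin-sum↔Σ (f ∘ suc) ⟩
  (Fin (f zero) ⊎ Σ (Fin n) (Fin ∘ f ∘ suc)) ↔⟨ Σ-Fin-suc↔⊎ (Fin ∘ f) ⟨
  Σ (Fin (suc n)) (Fin ∘ f)                 ∎
  where open EquationalReasoning

Fin-[≡]↔≡ : ∀ {n} (a b : Fin n) → Fin [ a ≡ᶠ b ] ↔ (a ≡ b)
Fin-[≡]↔≡ a b with a ≟ b
... | yes a≡b = prop-↔ (λ { zero zero → refl }) Fin-≡-irrelevant (λ _ → a≡b) (λ _ → zero)
... | no  a≢b = mk↔ₛ′ (λ ()) (⊥-elim ∘ a≢b) (⊥-elim ∘ a≢b) (λ ())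

module _ (D : Digraph) where
  open Digraph D

  walk-zero↔≡ : ∀ {x y} → Walk D 0 x y ↔ (x ≡ y)
  walk-zero↔≡ = mk↔ₛ′ (λ { [] → refl }) (λ { refl → [] }) (λ { refl → refl }) (λ { [] → refl })

  snoc : ∀ {ℓ x z} → Walk D ℓ x z → (a : Arc) → src a ≡ z → Walk D (suc ℓ) x (tgt a)
  snoc []             a a↦z = step a a↦z []
  snoc (step b b↦x w) a a↦z = step b b↦x (snoc w a a↦z)

  LastArc : ℕ → Vertex → Vertex → Set
  LastArc ℓ x y = Σ Arc λ a → Walk D ℓ x (src a) × (tgt a ≡ y)

  unsnoc : ∀ {ℓ x y} → Walk D (suc ℓ) x y → LastArc ℓ x y
  unsnoc {zero}  (step a refl []) = a , [] , refl
  unsnoc {suc ℓ} (step b b↦x w) with unsnoc w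
  ... | a , w′ , a↦y = a , step b b↦x w′ , a↦y

  snoc′ : ∀ {ℓ x y} → LastArc ℓ x y → Walk D (suc ℓ) x y
  snoc′ (a , w , refl) = snoc w a refl

  unsnoc-snoc : ∀ {ℓ x} a (w : Walk D ℓ x (src a)) → unsnoc (snoc w a refl) ≡ (a , w , refl)
  unsnoc-snoc a []             = refl
  unsnoc-snoc a (step b b↦x w) rewrite unsnoc-snoc a w = refl

  snoc-unsnoc : ∀ {ℓ x y} (w : Walk D (suc ℓ) x y) → snoc′ (unsnoc w) ≡ w
  snoc-unsnoc {zero}  (step a refl []) = refl
  snoc-unsnoc {suc ℓ} (step b b↦x w) with unsnoc w | snoc-unsnoc w
  ... | a , w′ , refl | snoc-unsnoc-w = cong (step b b↦x) snoc-unsnoc-w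

  walk-suc↔last-arc : ∀ {ℓ x y} → Walk D (suc ℓ) x y ↔ LastArc ℓ x y
  walk-suc↔last-arc = mk↔ₛ′ unsnoc snoc′ (λ { (a , w , refl) → unsnoc-snoc a w }) snoc-unsnoc

asGroup : ∀ {m} → FinGroup m → Group 0ℓ 0ℓ
asGroup G = record { isGroup = FinGroup.isGroup G }

module _ {m : ℕ} (G : FinGroup m) where
  open FinGroup G
  open IsGroup isGroup using (assoc; identityʳ)
  open GroupProperties (asGroup G) using (\\-leftDividesˡ; \\-leftDividesʳ; ∙-cancelˡ; identityʳ-unique)

  left-mult↔ : Fin m → Fin m ↔ Fin m
  left-mult↔ h = mk↔ₛ′ (h ∙_) ((h ⁻¹) ∙_) (\\-leftDividesˡ h) (\\-leftDividesʳ h)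

  fixes↔identity : ∀ h i → (h ≡ h ∙ i) ↔ (i ≡ ε)
  fixes↔identity h i = prop-↔ Fin-≡-irrelevant Fin-≡-irrelevant
    (λ h≡hi → identityʳ-unique h i (sym h≡hi)) (λ { refl → sym (identityʳ h) })

  translate↔ : ∀ h j g i → ((h ∙ j) ∙ g ≡ h ∙ i) ↔ (j ∙ g ≡ i)
  translate↔ h j g i = prop-↔ Fin-≡-irrelevant Fin-≡-irrelevant
    (λ hjg≡hi → ∙-cancelˡ h (j ∙ g) i (trans (sym (assoc h j g)) hjg≡hi))
    (λ { refl → assoc h j g })

  Convolution : (Fin m → Set) → (Fin m → Set) → Fin m → Set
  Convolution A B i = Σ (Fin m) λ j → Σ (Fin m) λ k → (j ∙ k ≡ i) × (A j × B k)

  Fin-conv↔ : ∀ (a b : Fin m → ℕ) i → Fin ((_*G_ G a b) i) ↔ Convolution (Fin ∘ a) (Fin ∘ b) i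
  Fin-conv↔ a b i =
    ↔-trans (Fin-sum↔Σ _) (congˡ λ {j} →
    ↔-trans (Fin-sum↔Σ _) (congˡ λ {k} →
    ↔-trans *↔× (×-cong (Fin-[≡]↔≡ (j ∙ k) i) *↔×)))

  Convolution-cong : ∀ {A A′ B B′ : Fin m → Set} →
    (∀ j → A j ↔ A′ j) → (∀ k → B k ↔ B′ k) → ∀ i → Convolution A B i ↔ Convolution A′ B′ i
  Convolution-cong A↔A′ B↔B′ i = congˡ λ {j} → congˡ λ {k} → ×-cong ↔-refl (×-cong (A↔A′ j) (B↔B′ k))

  module _ (Γ : VoltageDigraph m) where
    open VoltageDigraph Γ

    Fin-product↔ : ∀ (X Y : Mat G Γ) u v i →
      Fin (_·_ G Γ X Y u v i) ↔ Σ (Fin n) λ w → Convolution (Fin ∘ X u w) (Fin ∘ Y w v) i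
    Fin-product↔ X Y u v i = ↔-trans (Fin-sum↔Σ _) (congˡ λ {w} → Fin-conv↔ (X u w) (Y w v) i)

    Arcs : Fin n → Fin n → Fin m → Set
    Arcs w v g = Σ (Fin k) λ e → (src e ≡ w) × ((tgt e ≡ v) × (α e ≡ g))

    Fin-repMatrix↔ : ∀ w v g → Fin (repMatrix G Γ w v g) ↔ Arcs w v g
    Fin-repMatrix↔ w v g = ↔-trans (Fin-sum↔Σ _) (congˡ λ {e} →
      ↔-trans *↔× (×-cong (Fin-[≡]↔≡ (src e) w) (↔-trans *↔× (×-cong (Fin-[≡]↔≡ (tgt e) v) (Fin-[≡]↔≡ (α e) g)))))

    -- The data of a last step of a lift walk ending at (v, h g_i): an arc e and
    -- a relative voltage g_j at its source with g_j α(e) = g_i, where A w j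
    -- describes how (w, h g_j) is reached.
    LastStep : (Fin n → Fin m → Set) → Fin n → Fin m → Set
    LastStep A v i = Σ (Fin k) λ e → Σ (Fin m) λ j → A (src e) j × ((tgt e ≡ v) × (j ∙ α e ≡ i))

    LastStep-cong : ∀ {A A′ : Fin n → Fin m → Set} →
      (∀ w j → A w j ↔ A′ w j) → ∀ v i → LastStep A v i ↔ LastStep A′ v i
    LastStep-cong A↔A′ v i = congˡ λ {e} → congˡ λ {j} → ×-cong (A↔A′ (src e) j) ↔-refl

    -- In a product with B_G the middle vertex w = src e and the voltage
    -- g_k = α(e) are determined by the arc e, so they can be eliminated.
    product-with-arcs↔LastStep : ∀ (A : Fin n → Fin m → Set) v i →
      Σ (Fin n) (λ w → Convolution (A w) (Arcs w v) i) ↔ LastStep A v i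
    product-with-arcs↔LastStep A v i = mk↔ₛ′ to from (λ _ → refl) from∘to
      where
      to : Σ (Fin n) (λ w → Convolution (A w) (Arcs w v) i) → LastStep A v i
      to (_ , j , _ , j∙g≡i , a , e , refl , e↦v , refl) = e , j , a , e↦v , j∙g≡i
      from : LastStep A v i → Σ (Fin n) (λ w → Convolution (A w) (Arcs w v) i)
      from (e , j , a , e↦v , j∙αe≡i) = src e , j , α e , j∙αe≡i , a , e , refl , e↦v , refl
      from∘to : ∀ x → from (to x) ≡ x
      from∘to (_ , _ , _ , _ , _ , _ , refl , _ , refl) = refl

    Fin-times-repMatrix↔ : ∀ (X : Mat G Γ) u v i →
      Fin (_·_ G Γ X (repMatrix G Γ) u v i) ↔ LastStep (λ w j → Fin (X u w j)) v i
    Fin-times-repMatrix↔ X u v i = begin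
      Fin (_·_ G Γ X (repMatrix G Γ) u v i)
        ↔⟨ Fin-product↔ X (repMatrix G Γ) u v i ⟩
      Σ (Fin n) (λ w → Convolution (Fin ∘ X u w) (Fin ∘ repMatrix G Γ w v) i)
        ↔⟨ congˡ (λ {w} → Convolution-cong (λ _ → ↔-refl) (Fin-repMatrix↔ w v) i) ⟩
      Σ (Fin n) (λ w → Convolution (Fin ∘ X u w) (Arcs w v) i)
        ↔⟨ product-with-arcs↔LastStep (λ w j → Fin (X u w j)) v i ⟩
      LastStep (λ w j → Fin (X u w j)) v i
        ∎
      where open EquationalReasoning

    Γ^α : Digraph
    Γ^α = lift G Γ

    lift-walk-zero↔ : ∀ u v i h → Walk Γ^α 0 (u , h) (v , h ∙ i) ↔ Fin (idMat G Γ u v i)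
    lift-walk-zero↔ u v i h = begin
      Walk Γ^α 0 (u , h) (v , h ∙ i)     ↔⟨ walk-zero↔≡ Γ^α ⟩
      ((u , h) ≡ (v , h ∙ i))            ↔⟨ ×-≡,≡↔≡ ⟨
      (u ≡ v × h ≡ h ∙ i)                ↔⟨ ×-cong ↔-refl (fixes↔identity h i) ⟩
      (u ≡ v × i ≡ ε)                    ↔⟨ ×-cong (Fin-[≡]↔≡ u v) (Fin-[≡]↔≡ i ε) ⟨
      (Fin [ u ≡ᶠ v ] × Fin [ i ≡ᶠ ε ])  ↔⟨ *↔× ⟨
      Fin (idMat G Γ u v i)              ∎
      where open EquationalReasoning

    -- Walks of length ℓ+1 from (u,h) to (v, h g_i): split off the last arc
    -- (e, g) and write its starting voltage as g = h g_j.
    lift-walk-suc↔ : ∀ ℓ u v i h → Walk Γ^α (suc ℓ) (u , h) (v , h ∙ i)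
                     ↔ LastStep (λ w j → Walk Γ^α ℓ (u , h) (w , h ∙ j)) v i
    lift-walk-suc↔ ℓ u v i h = begin
      Walk Γ^α (suc ℓ) (u , h) (v , h ∙ i)
        ↔⟨ walk-suc↔last-arc Γ^α ⟩
      LastArc Γ^α ℓ (u , h) (v , h ∙ i)
        ↔⟨ Σ-assoc ⟩
      (Σ (Fin k) λ e → Σ (Fin m) λ g → Walk Γ^α ℓ (u , h) (src e , g) × ((tgt e , g ∙ α e) ≡ (v , h ∙ i)))
        ↔⟨ congˡ (Σ-↔ (left-mult↔ h) ↔-refl) ⟨
      (Σ (Fin k) λ e → Σ (Fin m) λ j → Walk Γ^α ℓ (u , h) (src e , h ∙ j) × ((tgt e , (h ∙ j) ∙ α e) ≡ (v , h ∙ i)))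
        ↔⟨ congˡ (λ {e} → congˡ λ {j} → ×-cong ↔-refl (↔-trans (↔-sym ×-≡,≡↔≡) (×-cong ↔-refl (translate↔ h j (α e) i)))) ⟩
      LastStep (λ w j → Walk Γ^α ℓ (u , h) (w , h ∙ j)) v i
        ∎
      where open EquationalReasoning

    walks↔power : ∀ ℓ u v i h →
      Walk Γ^α ℓ (u , h) (v , h ∙ i) ↔ Fin (_^G_ G Γ (repMatrix G Γ) ℓ u v i)
    walks↔power zero    u v i h = lift-walk-zero↔ u v i h
    walks↔power (suc ℓ) u v i h = begin
      Walk Γ^α (suc ℓ) (u , h) (v , h ∙ i)
        ↔⟨ lift-walk-suc↔ ℓ u v i h ⟩
      LastStep (λ w j → Walk Γ^α ℓ (u , h) (w , h ∙ j)) v i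
        ↔⟨ LastStep-cong (λ w j → walks↔power ℓ u w j h) v i ⟩
      LastStep (λ w j → Fin (_^G_ G Γ (repMatrix G Γ) ℓ u w j)) v i
        ↔⟨ Fin-times-repMatrix↔ (_^G_ G Γ (repMatrix G Γ) ℓ) u v i ⟨
      Fin (_^G_ G Γ (repMatrix G Γ) (suc ℓ) u v i)
        ∎
      where open EquationalReasoning

lemma4 : ∀ {m} (G : FinGroup m) (Γ : VoltageDigraph m) (ℓ : ℕ)
         (u v : Fin (VoltageDigraph.n Γ)) (i h : Fin m) →
         Walk (lift G Γ) ℓ (u , h) (v , FinGroup._∙_ G h i)
           ↔ Fin (_^G_ G Γ (repMatrix G Γ) ℓ u v i)
lemma4 G Γ = walks↔power G Γ
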